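{- For any integer $n\ge2$, $$\det[v_{|j-k|}(2,2)]_{1\le j,k\le n}=(-2)^nF_{2n-4}.$$
   Context: The sequence $(v_n(2,2))_{n\ge0}$ is defined by $v_0=2$, $v_1=2$, $v_{n+1}=2v_n-2v_{n-1}$ for $n\ge1$. The Fibonacci numbers are given by $F_0=0$, $F_1=1$, $F_{n+1}=F_n+F_{n-1}$ for $n\ge1$. -}

module Defs where

open import Data.Nat using (ℕ; zero; suc)
import Data.Nat as ℕ
open import Data.Integer using (ℤ; +_; -_; _+_; _-_; _*_; -1ℤ; 1ℤ; 0ℤ)
open import Data.Fin using (Fin; zero; suc; toℕ; punchIn)

v : ℕ → ℤ
v zero = + 2
v (suc zero) = + 2
v (suc (suc n)) = + 2 * v (suc n) - + 2 * v n

F : ℕ → ℕ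
F zero = 0
F (suc zero) = 1
F (suc (suc n)) = F (suc n) ℕ.+ F n

_^ᶻ_ : ℤ → ℕ → ℤ
x ^ᶻ zero = 1ℤ
x ^ᶻ suc n = x * (x ^ᶻ n)

Σᶠ : (n : ℕ) → (Fin n → ℤ) → ℤ
Σᶠ zero f = 0ℤ
Σᶠ (suc n) f = f zero + Σᶠ n (λ i → f (suc i))

-- determinant of an n×n integer matrix, by Laplace expansion along the first row
-- (equal to the usual Leibniz determinant)
det : (n : ℕ) → (Fin n → Fin n → ℤ) → ℤ
det zero M = 1ℤ
det (suc n) M =
  Σᶠ (suc n) (λ k → (-1ℤ ^ᶻ toℕ k) * (M zero k * det n (λ i j → M (suc i) (punchIn k j))))

dist : ℕ → ℕ → ℕ
dist a b = (a ℕ.∸ b) ℕ.+ (b ℕ.∸ a)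

{-# OPTIONS --safe #-}
module Submission where

-- Let Δ s m be the determinant of the (m+1)×(m+1) matrix [v_{|j-k|}] with its top row replaced by
-- (v_s, v_{s+1}, …). Since v_{t+2} − 2v_{t+1} + 2v_t = 0, adding −2·(column 1) + 2·(column 2) to
-- column 0 turns it into (c_s, 2, 0, …, 0) with c_s = v_s − 2v_{s+1} + 2v_{s+2}, and expanding
-- along it gives Δ s (m+2) = c_s · Δ 0 (m+1) − 2 · Δ (s+1) (m+1); linearity in the top row gives
-- Δ (s+2) = 2 Δ (s+1) − 2 Δ s. With c₀ = −2 and c₁ = −6, D = Δ 0 and E = Δ 1 evolve by
-- (D, E) ↦ −2 (D + E, D + 2E), which is −2 times two steps of the Fibonacci recurrence, so at size n
-- they equal (−2)^n (F_{2n−4}, F_{2n−3}).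

open import Defs
open import Data.Nat using (ℕ; zero; suc; _≥_; _∸_; s≤s)
import Data.Nat as ℕ
import Data.Nat.Properties as ℕ
open import Data.Integer using (ℤ; +_; +0; +[1+_]; -[1+_]; -_; _+_; _-_; _*_; -1ℤ; 1ℤ; 0ℤ)
import Data.Integer.Properties as ℤ
open import Data.Integer.Tactic.RingSolver using (solve-∀)
open import Data.Fin using (Fin; zero; suc; toℕ; punchIn)
open import Data.Vec.Functional using (Vector; _∷_; tail; removeAt)
open import Data.Vec.Functional.Properties using (∷-cong)
open import Data.Product using (_×_; _,_; proj₁; proj₂)
open import Function using (_∘_)
open import Relation.Binary.PropositionalEquality
  using (_≡_; _≗_; refl; sym; trans; cong; cong₂; module ≡-Reasoning)
open ≡-Reasoning

Σᶠ-cong : ∀ n {f g : Fin n → ℤ} → (∀ k → f k ≡ g k) → Σᶠ n f ≡ Σᶠ n g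
Σᶠ-cong zero    f≗g = refl
Σᶠ-cong (suc n) f≗g = cong₂ _+_ (f≗g zero) (Σᶠ-cong n (f≗g ∘ suc))

Σᶠ-zero : ∀ n {f : Fin n → ℤ} → (∀ k → f k ≡ 0ℤ) → Σᶠ n f ≡ 0ℤ
Σᶠ-zero zero    f≗0 = refl
Σᶠ-zero (suc n) f≗0 = cong₂ _+_ (f≗0 zero) (Σᶠ-zero n (f≗0 ∘ suc))

Σᶠ-distrib-+ : ∀ n (f g : Fin n → ℤ) → Σᶠ n (λ k → f k + g k) ≡ Σᶠ n f + Σᶠ n g
Σᶠ-distrib-+ zero    f g = refl
Σᶠ-distrib-+ (suc n) f g =
  trans (cong (_+_ (f zero + g zero)) (Σᶠ-distrib-+ n (f ∘ suc) (g ∘ suc)))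
        (interchange (f zero) (g zero) (Σᶠ n (f ∘ suc)) (Σᶠ n (g ∘ suc)))
  where
  interchange : ∀ a b c d → (a + b) + (c + d) ≡ (a + c) + (b + d)
  interchange = solve-∀

Σᶠ-distribˡ-* : ∀ n c (f : Fin n → ℤ) → Σᶠ n (λ k → c * f k) ≡ c * Σᶠ n f
Σᶠ-distribˡ-* zero    c f = sym (ℤ.*-zeroʳ c)
Σᶠ-distribˡ-* (suc n) c f =
  trans (cong (_+_ (c * f zero)) (Σᶠ-distribˡ-* n c (f ∘ suc))) (sym (ℤ.*-distribˡ-+ c _ _))

Σᶠ-neg : ∀ n (f : Fin n → ℤ) → Σᶠ n (λ k → - f k) ≡ - Σᶠ n f
Σᶠ-neg zero    f = refl
Σᶠ-neg (suc n) f = trans (cong (_+_ (- f zero)) (Σᶠ-neg n (f ∘ suc))) (sym (ℤ.neg-distrib-+ (f zero) _))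

d≡-d⇒d≡0 : ∀ d → d ≡ - d → d ≡ 0ℤ
d≡-d⇒d≡0 +0       _  = refl
d≡-d⇒d≡0 +[1+ _ ] ()
d≡-d⇒d≡0 -[1+ _ ] ()

Matrix : ℕ → Set
Matrix n = Fin n → Fin n → ℤ

sign : ∀ {n} → Fin n → ℤ
sign k = -1ℤ ^ᶻ toℕ k

minor : ∀ {m n} → (Fin (suc m) → Vector ℤ (suc n)) → Fin (suc n) → Fin m → Vector ℤ n
minor M k i = removeAt (M (suc i)) k

expansionTerm : ∀ {n} → Matrix (suc n) → Fin (suc n) → ℤ
expansionTerm {n} M k = sign k * (M zero k * det n (minor M k))

infixr 5 _∷ᶜ_
_∷ᶜ_ : ∀ {m n} → Vector ℤ m → (Fin m → Vector ℤ n) → Fin m → Vector ℤ (suc n)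
(x ∷ᶜ R) i = x i ∷ R i

removeAt-∷ : ∀ {n} (x : ℤ) (r : Vector ℤ (suc n)) k → removeAt (x ∷ r) (suc k) ≗ x ∷ removeAt r k
removeAt-∷ x r k = ∷-cong refl (λ _ → refl)

det-cong : ∀ n {M N : Matrix n} → (∀ i → M i ≗ N i) → det n M ≡ det n N
det-cong zero    M≗N = refl
det-cong (suc n) M≗N = Σᶠ-cong (suc n) λ k →
  cong₂ (λ a d → sign k * (a * d)) (M≗N zero k) (det-cong n (λ i → M≗N (suc i) ∘ punchIn k))

det-cong-col0 : ∀ n {x y : Vector ℤ (suc n)} (R : Fin (suc n) → Vector ℤ n) →
  (∀ i → x i ≡ y i) → det (suc n) (x ∷ᶜ R) ≡ det (suc n) (y ∷ᶜ R)
det-cong-col0 n {x} {y} R x≗y = det-cong (suc n) {x ∷ᶜ R} {y ∷ᶜ R} λ i → ∷-cong (x≗y i) (λ _ → refl)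

det-cong-row0 : ∀ n {r s : Vector ℤ (suc n)} (R : Fin n → Vector ℤ (suc n)) →
  r ≗ s → det (suc n) (r ∷ R) ≡ det (suc n) (s ∷ R)
det-cong-row0 n {r} {s} R r≗s = det-cong (suc n) {r ∷ R} {s ∷ R} λ where
  zero    → r≗s
  (suc i) → λ _ → refl

det-minor-∷ᶜ : ∀ {n} (x : Vector ℤ (suc (suc n))) (R : Fin (suc (suc n)) → Vector ℤ (suc n)) k →
  det (suc n) (minor (x ∷ᶜ R) (suc k)) ≡ det (suc n) (tail x ∷ᶜ minor R k)
det-minor-∷ᶜ x R k = det-cong _ λ i → removeAt-∷ (x (suc i)) (R (suc i)) k

det-linear-termwise : ∀ n a b (A B C : Matrix (suc n)) →
  (∀ k → expansionTerm C k ≡ a * expansionTerm A k + b * expansionTerm B k) →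
  det (suc n) C ≡ a * det (suc n) A + b * det (suc n) B
det-linear-termwise n a b A B C split = begin
  det (suc n) C
    ≡⟨ Σᶠ-cong (suc n) split ⟩
  Σᶠ (suc n) (λ k → a * expansionTerm A k + b * expansionTerm B k)
    ≡⟨ Σᶠ-distrib-+ (suc n) (λ k → a * expansionTerm A k) (λ k → b * expansionTerm B k) ⟩
  Σᶠ (suc n) (λ k → a * expansionTerm A k) + Σᶠ (suc n) (λ k → b * expansionTerm B k)
    ≡⟨ cong₂ _+_ (Σᶠ-distribˡ-* (suc n) a (expansionTerm A)) (Σᶠ-distribˡ-* (suc n) b (expansionTerm B)) ⟩
  a * det (suc n) A + b * det (suc n) B ∎

private
  linear-entry : ∀ a b σ x y d → σ * ((a * x + b * y) * d) ≡ a * (σ * (x * d)) + b * (σ * (y * d))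
  linear-entry = solve-∀

  linear-cofactor : ∀ a b σ e d d′ → σ * (e * (a * d + b * d′)) ≡ a * (σ * (e * d)) + b * (σ * (e * d′))
  linear-cofactor = solve-∀

det-linear-row0 : ∀ n a b (r s : Vector ℤ (suc n)) (R : Fin n → Vector ℤ (suc n)) →
  det (suc n) ((λ j → a * r j + b * s j) ∷ R) ≡ a * det (suc n) (r ∷ R) + b * det (suc n) (s ∷ R)
det-linear-row0 n a b r s R =
  det-linear-termwise n a b (r ∷ R) (s ∷ R) ((λ j → a * r j + b * s j) ∷ R) λ k →
    linear-entry a b (sign k) (r k) (s k) _

det-linear-col0 : ∀ n a b (x y : Vector ℤ (suc n)) (R : Fin (suc n) → Vector ℤ n) →
  det (suc n) ((λ i → a * x i + b * y i) ∷ᶜ R) ≡ a * det (suc n) (x ∷ᶜ R) + b * det (suc n) (y ∷ᶜ R)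
det-linear-col0 zero a b x y R =
  det-linear-termwise 0 a b (x ∷ᶜ R) (y ∷ᶜ R) ((λ i → a * x i + b * y i) ∷ᶜ R) λ where
  zero → linear-entry a b 1ℤ (x zero) (y zero) 1ℤ
det-linear-col0 (suc n) a b x y R = det-linear-termwise (suc n) a b (x ∷ᶜ R) (y ∷ᶜ R) (z ∷ᶜ R) term
  where
  z : Vector ℤ (suc (suc n))
  z i = a * x i + b * y i

  term : ∀ k → expansionTerm (z ∷ᶜ R) k ≡ a * expansionTerm (x ∷ᶜ R) k + b * expansionTerm (y ∷ᶜ R) k
  term zero    = linear-entry a b 1ℤ (x zero) (y zero) _
  term (suc k) = trans (cong (λ d → sign (suc k) * (R zero k * d)) (begin
      det (suc n) (minor (z ∷ᶜ R) (suc k))  ≡⟨ det-minor-∷ᶜ z R k ⟩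
      det (suc n) (tail z ∷ᶜ minor R k)     ≡⟨ det-linear-col0 n a b (tail x) (tail y) (minor R k) ⟩
      a * det (suc n) (tail x ∷ᶜ minor R k) + b * det (suc n) (tail y ∷ᶜ minor R k)
        ≡⟨ sym (cong₂ (λ d d′ → a * d + b * d′) (det-minor-∷ᶜ x R k) (det-minor-∷ᶜ y R k)) ⟩
      a * det (suc n) (minor (x ∷ᶜ R) (suc k)) + b * det (suc n) (minor (y ∷ᶜ R) (suc k)) ∎))
    (linear-cofactor a b (sign (suc k)) (R zero k) _ _)

det-minor-∷ᶜ∷ᶜ : ∀ {n} (x y : Vector ℤ (suc (suc (suc n)))) (R : Fin (suc (suc (suc n))) → Vector ℤ (suc n)) k →
  det (suc (suc n)) (minor (x ∷ᶜ y ∷ᶜ R) (suc (suc k))) ≡ det (suc (suc n)) (tail x ∷ᶜ tail y ∷ᶜ minor R k)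
det-minor-∷ᶜ∷ᶜ x y R k =
  det-cong _ {minor (x ∷ᶜ y ∷ᶜ R) (suc (suc k))} {tail x ∷ᶜ tail y ∷ᶜ minor R k} λ i →
    ∷-cong refl (removeAt-∷ (y (suc i)) (R (suc i)) k)

private
  negate-cofactor : ∀ σ e d → σ * (e * (- d)) ≡ - (σ * (e * d))
  negate-cofactor = solve-∀

  annihilate-cofactor : ∀ σ e → σ * (e * 0ℤ) ≡ 0ℤ
  annihilate-cofactor = solve-∀

  first-term-only : ∀ e → 1ℤ * e + 0ℤ ≡ e
  first-term-only = solve-∀

det-swap-col01 : ∀ n (x y : Vector ℤ (suc (suc n))) (R : Fin (suc (suc n)) → Vector ℤ n) →
  det (suc (suc n)) (y ∷ᶜ x ∷ᶜ R) ≡ - det (suc (suc n)) (x ∷ᶜ y ∷ᶜ R)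

swap-col01-later : ∀ n (x y : Vector ℤ (suc (suc n))) (R : Fin (suc (suc n)) → Vector ℤ n) →
  Σᶠ n (λ k → expansionTerm (y ∷ᶜ x ∷ᶜ R) (suc (suc k))) ≡
  - Σᶠ n (λ k → expansionTerm (x ∷ᶜ y ∷ᶜ R) (suc (suc k)))

det-swap-col01 n x y R = begin
  det (suc (suc n)) (y ∷ᶜ x ∷ᶜ R)
    ≡⟨⟩
  1ℤ * (y zero * P) + ((-1ℤ * 1ℤ) * (x zero * det (suc n) (minor (y ∷ᶜ x ∷ᶜ R) (suc zero)))
                      + later (y ∷ᶜ x ∷ᶜ R))
    ≡⟨ cong₂ (λ d s → 1ℤ * (y zero * P) + ((-1ℤ * 1ℤ) * (x zero * d) + s))
             (det-minor-∷ᶜ y (x ∷ᶜ R) zero) (swap-col01-later n x y R) ⟩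
  1ℤ * (y zero * P) + ((-1ℤ * 1ℤ) * (x zero * Q) + - later (x ∷ᶜ y ∷ᶜ R))
    ≡⟨ exchange (x zero) (y zero) P Q _ ⟩
  - (1ℤ * (x zero * Q) + ((-1ℤ * 1ℤ) * (y zero * P) + later (x ∷ᶜ y ∷ᶜ R)))
    ≡⟨ cong (λ d → - (1ℤ * (x zero * Q) + ((-1ℤ * 1ℤ) * (y zero * d) + later (x ∷ᶜ y ∷ᶜ R))))
            (sym (det-minor-∷ᶜ x (y ∷ᶜ R) zero)) ⟩
  - det (suc (suc n)) (x ∷ᶜ y ∷ᶜ R) ∎
  where
  P Q : ℤ
  P = det (suc n) (tail x ∷ᶜ tail R)
  Q = det (suc n) (tail y ∷ᶜ tail R)

  later : Matrix (suc (suc n)) → ℤ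
  later M = Σᶠ n (λ k → expansionTerm M (suc (suc k)))

  exchange : ∀ a b p q s →
    1ℤ * (b * p) + ((-1ℤ * 1ℤ) * (a * q) + - s) ≡ - (1ℤ * (a * q) + ((-1ℤ * 1ℤ) * (b * p) + s))
  exchange = solve-∀

swap-col01-later zero    x y R = refl
swap-col01-later (suc n) x y R =
  trans (Σᶠ-cong (suc n) swap-minor) (Σᶠ-neg (suc n) (λ k → expansionTerm (x ∷ᶜ y ∷ᶜ R) (suc (suc k))))
  where
  swap-minor : ∀ k →
    expansionTerm (y ∷ᶜ x ∷ᶜ R) (suc (suc k)) ≡ - expansionTerm (x ∷ᶜ y ∷ᶜ R) (suc (suc k))
  swap-minor k = trans (cong (λ d → sign (suc (suc k)) * (R zero k * d)) (begin
      det (suc (suc n)) (minor (y ∷ᶜ x ∷ᶜ R) (suc (suc k)))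
        ≡⟨ det-minor-∷ᶜ∷ᶜ y x R k ⟩
      det (suc (suc n)) (tail y ∷ᶜ tail x ∷ᶜ minor R k)
        ≡⟨ det-swap-col01 n (tail x) (tail y) (minor R k) ⟩
      - det (suc (suc n)) (tail x ∷ᶜ tail y ∷ᶜ minor R k)
        ≡⟨ cong -_ (sym (det-minor-∷ᶜ∷ᶜ x y R k)) ⟩
      - det (suc (suc n)) (minor (x ∷ᶜ y ∷ᶜ R) (suc (suc k))) ∎))
    (negate-cofactor (sign (suc (suc k))) (R zero k) _)

det-equal-col01 : ∀ n (x : Vector ℤ (suc (suc n))) (R : Fin (suc (suc n)) → Vector ℤ n) →
  det (suc (suc n)) (x ∷ᶜ x ∷ᶜ R) ≡ 0ℤ
det-equal-col01 n x R = d≡-d⇒d≡0 _ (det-swap-col01 n x x R)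

det-equal-col02 : ∀ n (x y : Vector ℤ (suc (suc (suc n)))) (R : Fin (suc (suc (suc n))) → Vector ℤ n) →
  det (suc (suc (suc n))) (x ∷ᶜ y ∷ᶜ x ∷ᶜ R) ≡ 0ℤ

equal-col02-later : ∀ n (x y : Vector ℤ (suc (suc (suc n)))) (R : Fin (suc (suc (suc n))) → Vector ℤ n) →
  Σᶠ n (λ k → expansionTerm (x ∷ᶜ y ∷ᶜ x ∷ᶜ R) (suc (suc (suc k)))) ≡ 0ℤ

det-equal-col02 n x y R = begin
  det (suc (suc (suc n))) M
    ≡⟨⟩
  1ℤ * (x zero * P) + ((-1ℤ * 1ℤ) * (y zero * det (suc (suc n)) (minor M (suc zero)))
                      + (1ℤ * (x zero * det (suc (suc n)) (minor M (suc (suc zero)))) + S))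
    ≡⟨ cong₂ (λ d d′ → 1ℤ * (x zero * P) + ((-1ℤ * 1ℤ) * (y zero * d) + (1ℤ * (x zero * d′) + S)))
             (trans (det-minor-∷ᶜ x (y ∷ᶜ x ∷ᶜ R) zero) (det-equal-col01 _ (tail x) (tail R)))
             (trans (det-minor-∷ᶜ∷ᶜ x y (x ∷ᶜ R) zero) (det-swap-col01 _ (tail y) (tail x) (tail R))) ⟩
  1ℤ * (x zero * P) + ((-1ℤ * 1ℤ) * (y zero * 0ℤ) + (1ℤ * (x zero * - P) + S))
    ≡⟨ cong (λ s → 1ℤ * (x zero * P) + ((-1ℤ * 1ℤ) * (y zero * 0ℤ) + (1ℤ * (x zero * - P) + s)))
            (equal-col02-later n x y R) ⟩
  1ℤ * (x zero * P) + ((-1ℤ * 1ℤ) * (y zero * 0ℤ) + (1ℤ * (x zero * - P) + 0ℤ))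
    ≡⟨ cancel (x zero) (y zero) P ⟩
  0ℤ ∎
  where
  M : Matrix (suc (suc (suc n)))
  M = x ∷ᶜ y ∷ᶜ x ∷ᶜ R

  P S : ℤ
  P = det (suc (suc n)) (tail y ∷ᶜ tail x ∷ᶜ tail R)
  S = Σᶠ n (λ k → expansionTerm M (suc (suc (suc k))))

  cancel : ∀ a b p → 1ℤ * (a * p) + ((-1ℤ * 1ℤ) * (b * 0ℤ) + (1ℤ * (a * - p) + 0ℤ)) ≡ 0ℤ
  cancel = solve-∀

equal-col02-later zero    x y R = refl
equal-col02-later (suc n) x y R = Σᶠ-zero (suc n) λ k →
  trans (cong (λ d → sign (suc (suc (suc k))) * (R zero k * d)) (begin
      det (suc (suc (suc n))) (minor (x ∷ᶜ y ∷ᶜ x ∷ᶜ R) (suc (suc (suc k))))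
        ≡⟨ det-minor-∷ᶜ∷ᶜ x y (x ∷ᶜ R) (suc k) ⟩
      det (suc (suc (suc n))) (tail x ∷ᶜ tail y ∷ᶜ minor (x ∷ᶜ R) (suc k))
        ≡⟨ det-cong _ {tail x ∷ᶜ tail y ∷ᶜ minor (x ∷ᶜ R) (suc k)} {tail x ∷ᶜ tail y ∷ᶜ tail x ∷ᶜ minor R k}
             (λ i → ∷-cong refl (∷-cong refl (removeAt-∷ (x (suc i)) (R (suc i)) k))) ⟩
      det (suc (suc (suc n))) (tail x ∷ᶜ tail y ∷ᶜ tail x ∷ᶜ minor R k)
        ≡⟨ det-equal-col02 n (tail x) (tail y) (minor R k) ⟩
      0ℤ ∎))
    (annihilate-cofactor (sign (suc (suc (suc k)))) (R zero k))

det-zero-col0 : ∀ n (R : Fin (suc n) → Vector ℤ n) → det (suc n) ((λ _ → 0ℤ) ∷ᶜ R) ≡ 0ℤ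
-- The zero column is 1·0 + (−1)·0, so linearity gives d = d − d.
det-zero-col0 n R =
  trans (det-linear-col0 n 1ℤ -1ℤ (λ _ → 0ℤ) (λ _ → 0ℤ) R) (cancel (det (suc n) ((λ _ → 0ℤ) ∷ᶜ R)))
  where
  cancel : ∀ d → 1ℤ * d + -1ℤ * d ≡ 0ℤ
  cancel = solve-∀

det-expand-col0₁ : ∀ n (x : Vector ℤ (suc n)) (R : Fin (suc n) → Vector ℤ n) →
  (∀ i → x (suc i) ≡ 0ℤ) → det (suc n) (x ∷ᶜ R) ≡ x zero * det n (tail R)
det-expand-col0₁ zero    x R _   = first-term-only (x zero * 1ℤ)
det-expand-col0₁ (suc n) x R x≡0 =
  trans (cong (_+_ (1ℤ * (x zero * det (suc n) (tail R)))) (Σᶠ-zero (suc n) vanish)) (first-term-only _)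
  where

  vanish : ∀ k → expansionTerm (x ∷ᶜ R) (suc k) ≡ 0ℤ
  vanish k = trans (cong (λ d → sign (suc k) * (R zero k * d)) (begin
      det (suc n) (minor (x ∷ᶜ R) (suc k))  ≡⟨ det-minor-∷ᶜ x R k ⟩
      det (suc n) (tail x ∷ᶜ minor R k)     ≡⟨ det-cong-col0 n (minor R k) x≡0 ⟩
      det (suc n) ((λ _ → 0ℤ) ∷ᶜ minor R k) ≡⟨ det-zero-col0 n (minor R k) ⟩
      0ℤ                                    ∎))
    (annihilate-cofactor (sign (suc k)) (R zero k))

det-expand-col0₂ : ∀ n (u : Vector ℤ (suc (suc n))) (R : Fin (suc (suc n)) → Vector ℤ (suc n)) →
  (∀ i → u (suc (suc i)) ≡ 0ℤ) →
  det (suc (suc n)) (u ∷ᶜ R) ≡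
  u zero * det (suc n) (tail R) - u (suc zero) * det (suc n) (R zero ∷ tail (tail R))
det-expand-col0₂ n u R u≡0 = begin
  1ℤ * (u zero * det (suc n) (tail R)) + Σᶠ (suc n) (λ k → expansionTerm (u ∷ᶜ R) (suc k))
    ≡⟨ cong (_+_ (1ℤ * (u zero * det (suc n) (tail R)))) (Σᶠ-cong (suc n) later) ⟩
  1ℤ * (u zero * det (suc n) (tail R)) + Σᶠ (suc n) (λ k → - u (suc zero) * expansionTerm N k)
    ≡⟨ cong (_+_ (1ℤ * (u zero * det (suc n) (tail R))))
            (Σᶠ-distribˡ-* (suc n) (- u (suc zero)) (expansionTerm N)) ⟩
  1ℤ * (u zero * det (suc n) (tail R)) + - u (suc zero) * det (suc n) N
    ≡⟨ tidy (u zero) (u (suc zero)) _ _ ⟩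
  u zero * det (suc n) (tail R) - u (suc zero) * det (suc n) N ∎
  where
  N : Matrix (suc n)
  N = R zero ∷ tail (tail R)

  tidy : ∀ a b d e → 1ℤ * (a * d) + - b * e ≡ a * d - b * e
  tidy = solve-∀

  move-sign : ∀ b σ e d → (-1ℤ * σ) * (e * (b * d)) ≡ - b * (σ * (e * d))
  move-sign = solve-∀

  later : ∀ k → expansionTerm (u ∷ᶜ R) (suc k) ≡ - u (suc zero) * expansionTerm N k
  later k = trans (cong (λ d → sign (suc k) * (R zero k * d))
                        (trans (det-minor-∷ᶜ u R k) (det-expand-col0₁ n (tail u) (minor R k) u≡0)))
                  (move-sign (u (suc zero)) (sign k) (R zero k) _)

det-add-cols-to-col0 : ∀ n a b (x y z : Vector ℤ (suc (suc (suc n)))) (R : Fin (suc (suc (suc n))) → Vector ℤ n) →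
  det (suc (suc (suc n))) ((λ i → x i + a * y i + b * z i) ∷ᶜ y ∷ᶜ z ∷ᶜ R) ≡
  det (suc (suc (suc n))) (x ∷ᶜ y ∷ᶜ z ∷ᶜ R)
det-add-cols-to-col0 n a b x y z R = begin
  det N ((λ i → x i + a * y i + b * z i) ∷ᶜ C)
    ≡⟨ det-cong-col0 _ C (λ i → regroup a b (x i) (y i) (z i)) ⟩
  det N ((λ i → 1ℤ * w i + b * z i) ∷ᶜ C)
    ≡⟨ det-linear-col0 _ 1ℤ b w z C ⟩
  1ℤ * det N (w ∷ᶜ C) + b * det N (z ∷ᶜ y ∷ᶜ z ∷ᶜ R)
    ≡⟨ cong₂ (λ d e → 1ℤ * d + b * e) (det-linear-col0 _ 1ℤ a x y C) (det-equal-col02 n z y R) ⟩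
  1ℤ * (1ℤ * det N (x ∷ᶜ C) + a * det N (y ∷ᶜ y ∷ᶜ z ∷ᶜ R)) + b * 0ℤ
    ≡⟨ cong (λ e → 1ℤ * (1ℤ * det N (x ∷ᶜ C) + a * e) + b * 0ℤ) (det-equal-col01 (suc n) y (z ∷ᶜ R)) ⟩
  1ℤ * (1ℤ * det N (x ∷ᶜ C) + a * 0ℤ) + b * 0ℤ
    ≡⟨ drop-zeros a b _ ⟩
  det N (x ∷ᶜ C) ∎
  where
  N : ℕ
  N = suc (suc (suc n))

  C : Fin N → Vector ℤ (suc (suc n))
  C = y ∷ᶜ z ∷ᶜ R

  w : Vector ℤ N
  w i = 1ℤ * x i + a * y i

  regroup : ∀ a b p q r → p + a * q + b * r ≡ 1ℤ * (1ℤ * p + a * q) + b * r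
  regroup = solve-∀

  drop-zeros : ∀ a b d → 1ℤ * (1ℤ * d + a * 0ℤ) + b * 0ℤ ≡ d
  drop-zeros = solve-∀

toeplitz : ∀ n → Matrix n
toeplitz n j k = v (dist (toℕ j) (toℕ k))

shifted : ℕ → ∀ {n} → Vector ℤ n
shifted s j = v (s ℕ.+ toℕ j)

Δ : ℕ → ℕ → ℤ
Δ s m = det (suc m) (shifted s ∷ tail (toeplitz (suc m)))

dist-zeroˡ : ∀ t → dist 0 t ≡ t
dist-zeroˡ t = cong (ℕ._+ t) (ℕ.0∸n≡0 t)

dist-zeroʳ : ∀ t → dist t 0 ≡ t ℕ.+ 0
dist-zeroʳ t = cong (t ℕ.+_) (ℕ.0∸n≡0 t)

det-toeplitz≡Δ₀ : ∀ m → det (suc m) (toeplitz (suc m)) ≡ Δ 0 m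
det-toeplitz≡Δ₀ m = det-cong-row0 m (tail (toeplitz (suc m))) λ j → cong v (dist-zeroˡ (toℕ j))

Δ-shift : ∀ s m → Δ (suc (suc s)) m ≡ + 2 * Δ (suc s) m - + 2 * Δ s m
Δ-shift s m = begin
  det (suc m) (shifted (suc (suc s)) ∷ R)
    ≡⟨ det-cong-row0 m R (λ j → recurrence (shifted (suc s) j) (shifted s j)) ⟩
  det (suc m) ((λ j → + 2 * shifted (suc s) j + - + 2 * shifted s j) ∷ R)
    ≡⟨ det-linear-row0 m (+ 2) (- + 2) (shifted (suc s)) (shifted s) R ⟩
  + 2 * Δ (suc s) m + - + 2 * Δ s m
    ≡⟨ sym (recurrence (Δ (suc s) m) (Δ s m)) ⟩
  + 2 * Δ (suc s) m - + 2 * Δ s m ∎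
  where
  R : Fin m → Vector ℤ (suc m)
  R = tail (toeplitz (suc m))

  recurrence : ∀ a b → + 2 * a - + 2 * b ≡ + 2 * a + - + 2 * b
  recurrence = solve-∀

v-annihilated : ∀ t → v (suc (suc t)) + - + 2 * v (suc t) + + 2 * v t ≡ 0ℤ
v-annihilated t = cancel (v (suc t)) (v t)
  where
  cancel : ∀ a b → (+ 2 * a - + 2 * b) + - + 2 * a + + 2 * b ≡ 0ℤ
  cancel = solve-∀

Δ-expand : ∀ s n → Δ s (suc (suc n)) ≡
  (v (s ℕ.+ 0) + - + 2 * v (s ℕ.+ 1) + + 2 * v (s ℕ.+ 2)) * Δ 0 (suc n) - + 2 * Δ (suc s) (suc n)
Δ-expand s n = begin
  det N M
    ≡⟨ det-cong N {M} {x ∷ᶜ y ∷ᶜ z ∷ᶜ R} (λ i → ∷-cong refl (∷-cong refl (∷-cong refl λ _ → refl))) ⟩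
  det N (x ∷ᶜ y ∷ᶜ z ∷ᶜ R)
    ≡⟨ sym (det-add-cols-to-col0 n (- + 2) (+ 2) x y z R) ⟩
  det N (u ∷ᶜ y ∷ᶜ z ∷ᶜ R)
    ≡⟨ det-expand-col0₂ (suc n) u S u-vanishes ⟩
  u zero * det (suc (suc n)) (tail S) - u (suc zero) * det (suc (suc n)) (S zero ∷ tail (tail S))
    ≡⟨ cong₂ (λ d d′ → u zero * d - + 2 * d′) lower-block top-shifted ⟩
  u zero * Δ 0 (suc n) - + 2 * Δ (suc s) (suc n) ∎
  where
  N : ℕ
  N = suc (suc (suc n))

  M : Matrix N
  M = shifted s ∷ tail (toeplitz N)

  x y z u : Vector ℤ N
  x i = M i zero
  y i = M i (suc zero)
  z i = M i (suc (suc zero))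
  u i = x i + - + 2 * y i + + 2 * z i

  R : Fin N → Vector ℤ n
  R i j = M i (suc (suc (suc j)))

  S : Fin N → Vector ℤ (suc (suc n))
  S = y ∷ᶜ z ∷ᶜ R

  u-vanishes : ∀ i → u (suc (suc i)) ≡ 0ℤ
  u-vanishes i = trans (cong (λ t → v (suc (suc (toℕ i ℕ.+ 0))) + - + 2 * v (suc (toℕ i ℕ.+ 0)) + + 2 * v t)
                              (dist-zeroʳ (toℕ i)))
                       (v-annihilated (toℕ i ℕ.+ 0))

  lower-block : det (suc (suc n)) (tail S) ≡ Δ 0 (suc n)
  lower-block = trans (det-cong (suc (suc n)) {tail S} {toeplitz (suc (suc n))}
                        (λ i → ∷-cong refl (∷-cong refl λ _ → refl)))
                      (det-toeplitz≡Δ₀ (suc n))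

  top-shifted : det (suc (suc n)) (S zero ∷ tail (tail S)) ≡ Δ (suc s) (suc n)
  top-shifted =
    det-cong (suc (suc n)) {S zero ∷ tail (tail S)} {shifted (suc s) ∷ tail (toeplitz (suc (suc n)))} λ where
      zero    j → trans (∷-cong {xs = S zero} {ys = tail (shifted s)} refl (∷-cong refl λ _ → refl) j)
                        (cong v (ℕ.+-suc s (toℕ j)))
      (suc i) → ∷-cong refl (∷-cong refl λ _ → refl)

Δ₀-step : ∀ n → Δ 0 (suc (suc n)) ≡ - + 2 * (Δ 0 (suc n) + Δ 1 (suc n))
Δ₀-step n = trans (Δ-expand 0 n) (regroup (Δ 0 (suc n)) (Δ 1 (suc n)))
  where
  regroup : ∀ d e → - + 2 * d - + 2 * e ≡ - + 2 * (d + e)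
  regroup = solve-∀

Δ₁-step : ∀ n → Δ 1 (suc (suc n)) ≡ - + 2 * (Δ 0 (suc n) + + 2 * Δ 1 (suc n))
Δ₁-step n = begin
  Δ 1 (suc (suc n))
    ≡⟨ Δ-expand 1 n ⟩
  - + 6 * Δ 0 (suc n) - + 2 * Δ 2 (suc n)
    ≡⟨ cong (λ d → - + 6 * Δ 0 (suc n) - + 2 * d) (Δ-shift 0 (suc n)) ⟩
  - + 6 * Δ 0 (suc n) - + 2 * (+ 2 * Δ 1 (suc n) - + 2 * Δ 0 (suc n))
    ≡⟨ regroup (Δ 0 (suc n)) (Δ 1 (suc n)) ⟩
  - + 2 * (Δ 0 (suc n) + + 2 * Δ 1 (suc n)) ∎
  where
  regroup : ∀ d e → - + 6 * d - + 2 * (+ 2 * e - + 2 * d) ≡ - + 2 * (d + + 2 * e)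
  regroup = solve-∀

Δ-closed-form : ∀ p → Δ 0 (suc p) ≡ (- + 2) ^ᶻ suc (suc p) * + F (p ℕ.+ p)
               × Δ 1 (suc p) ≡ (- + 2) ^ᶻ suc (suc p) * + F (suc (p ℕ.+ p))
Δ-closed-form zero = refl , refl
Δ-closed-form (suc p) rewrite ℕ.+-suc p p = D-next , E-next
  where
  k : ℕ
  k = p ℕ.+ p

  c f₀ f₁ : ℤ
  c  = (- + 2) ^ᶻ suc (suc p)
  f₀ = + F k
  f₁ = + F (suc k)

  D≡ : Δ 0 (suc p) ≡ c * f₀
  D≡ = proj₁ (Δ-closed-form p)

  E≡ : Δ 1 (suc p) ≡ c * f₁
  E≡ = proj₂ (Δ-closed-form p)

  step₀ : ∀ c a b → - + 2 * (c * a + c * b) ≡ - + 2 * c * (b + a)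
  step₀ = solve-∀

  step₁ : ∀ c a b → - + 2 * (c * a + + 2 * (c * b)) ≡ - + 2 * c * ((b + a) + b)
  step₁ = solve-∀

  D-next : Δ 0 (suc (suc p)) ≡ - + 2 * c * + F (suc (suc k))
  D-next = begin
    Δ 0 (suc (suc p))                    ≡⟨ Δ₀-step p ⟩
    - + 2 * (Δ 0 (suc p) + Δ 1 (suc p))  ≡⟨ cong₂ (λ d e → - + 2 * (d + e)) D≡ E≡ ⟩
    - + 2 * (c * f₀ + c * f₁)            ≡⟨ step₀ c f₀ f₁ ⟩
    - + 2 * c * (f₁ + f₀)                ≡⟨ cong (- + 2 * c *_) (sym (ℤ.pos-+ (F (suc k)) (F k))) ⟩
    - + 2 * c * + F (suc (suc k))        ∎

  E-next : Δ 1 (suc (suc p)) ≡ - + 2 * c * + F (suc (suc (suc k)))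
  E-next = begin
    Δ 1 (suc (suc p))
      ≡⟨ Δ₁-step p ⟩
    - + 2 * (Δ 0 (suc p) + + 2 * Δ 1 (suc p))
      ≡⟨ cong₂ (λ d e → - + 2 * (d + + 2 * e)) D≡ E≡ ⟩
    - + 2 * (c * f₀ + + 2 * (c * f₁))
      ≡⟨ step₁ c f₀ f₁ ⟩
    - + 2 * c * ((f₁ + f₀) + f₁)
      ≡⟨ cong (λ f → - + 2 * c * (f + f₁)) (sym (ℤ.pos-+ (F (suc k)) (F k))) ⟩
    - + 2 * c * (+ F (suc (suc k)) + f₁)
      ≡⟨ cong (- + 2 * c *_) (sym (ℤ.pos-+ (F (suc (suc k))) (F (suc k)))) ⟩
    - + 2 * c * + F (suc (suc (suc k))) ∎

corollary1p6 : (n : ℕ) → n ≥ 2 →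
    det n (λ j k → v (dist (toℕ j) (toℕ k))) ≡ ((- (+ 2)) ^ᶻ n) * (+ F (2 ℕ.* n ∸ 4))
corollary1p6 (suc (suc p)) (s≤s (s≤s _)) = begin
  det (suc (suc p)) (toeplitz (suc (suc p)))    ≡⟨ det-toeplitz≡Δ₀ (suc p) ⟩
  Δ 0 (suc p)                                   ≡⟨ proj₁ (Δ-closed-form p) ⟩
  (- + 2) ^ᶻ suc (suc p) * + F (p ℕ.+ p)        ≡⟨ cong (λ m → (- + 2) ^ᶻ suc (suc p) * + F m) (sym index) ⟩
  (- + 2) ^ᶻ suc (suc p) * + F (2 ℕ.* suc (suc p) ∸ 4) ∎
  where
  index : 2 ℕ.* suc (suc p) ∸ 4 ≡ p ℕ.+ p
  index rewrite ℕ.+-identityʳ p | ℕ.+-suc p (suc p) | ℕ.+-suc p p = refl
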